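{- Let $A$ be an $m\times n$ $(0,1)$-matrix, and let $t\ge 2$ be an integer. Then there exists a $(0,1)$-matrix $B\le A$ such that (i) $r_i(B)\le t$ for $i=1,\ldots,m$ and $s_j(B)\le 1$ for $j=1,\ldots,n$; (ii) $\rho_t(A)=\sigma(B)=\sigma(B[*,K])=|K|$, where $K=\{j: 1\le j\le n,\ s_j(B)=1\}$; (iii) there is a $(0,1)$-matrix $C\le B$ such that $r_i(C)\le t-1$ for $i=1,\ldots,m$, $s_j(C)\le 1$ for $j=1,\ldots,n$, and $\rho_{t-1}(A)=\sigma(C)=\sigma(C[*,K'])$ for some $K'\subseteq K$ with $|K'|=\rho_{t-1}(A)$.
   Context: For real $m\times n$ matrices $X=[x_{ij}],Y=[y_{ij}]$, $X\le Y$ means $x_{ij}\le y_{ij}$ for all $i,j$. $\sigma(X)$ is the sum of all entries of $X$; $r_i(X)$ is the $i$th row sum and $s_j(X)$ the $j$th column sum of $X$. For $K\subseteq\{1,\ldots,n\}$, $X[*,K]$ is the submatrix of $X$ formed by the columns with index in $K$. For a $(0,1)$-matrix $A$ and positive integer $t$, the $t$-term rank $\rho_t(A)$ is the maximum number of $1$s of $A$ that can be chosen with at most one chosen $1$ in each column and at most $t$ chosen $1$s in each row; equivalently $\rho_t(A)=\max\{\sigma(B): B\le A,\ r_i(B)\le t\ \forall i,\ s_j(B)\le 1\ \forall j\}$ over $(0,1)$-matrices $B$. -}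

module Defs where

open import Data.Nat using (ℕ; zero; suc; _+_; _≤_; _≟_)
open import Data.Fin using (Fin)
open import Data.Fin.Subset using (Subset)
open import Relation.Binary.PropositionalEquality using (_≡_)
open import Data.Sum using (_⊎_)
open import Data.Vec using (tabulate; lookup)
open import Data.Product using (_×_; Σ)
open import Data.Bool using (Bool; true; false)
open import Relation.Nullary.Decidable using (does)

-- Real m×n matrices restricted to (0,1)-matrices: entries in ℕ, each 0 or 1.
Matrix : ℕ → ℕ → Set
Matrix m n = Fin m → Fin n → ℕ

∑ : (k : ℕ) → (Fin k → ℕ) → ℕ
∑ zero    f = 0
∑ (suc k) f = f Fin.zero + ∑ k (λ i → f (Fin.suc i))

Is01 : {m n : ℕ} → Matrix m n → Set
Is01 {m} {n} X = (i : Fin m) (j : Fin n) → (X i j ≡ 0) ⊎ (X i j ≡ 1)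

_≤ₘ_ : {m n : ℕ} → Matrix m n → Matrix m n → Set
_≤ₘ_ {m} {n} X Y = (i : Fin m) (j : Fin n) → X i j ≤ Y i j

σ : {m n : ℕ} → Matrix m n → ℕ
σ {m} {n} X = ∑ m (λ i → ∑ n (λ j → X i j))

r : {m n : ℕ} → Matrix m n → Fin m → ℕ
r {m} {n} X i = ∑ n (λ j → X i j)

s : {m n : ℕ} → Matrix m n → Fin n → ℕ
s {m} {n} X j = ∑ m (λ i → X i j)

σCols : {m n : ℕ} → Matrix m n → Subset n → ℕ
σCols {m} {n} X K = ∑ m (λ i → ∑ n (λ j → sel (lookup K j) (X i j)))
  where
  sel : Bool → ℕ → ℕ
  sel true  x = x
  sel false x = 0

Admissible : {m n : ℕ} → ℕ → Matrix m n → Matrix m n → Set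
Admissible {m} {n} t A B =
  Is01 B × B ≤ₘ A × ((i : Fin m) → r B i ≤ t) × ((j : Fin n) → s B j ≤ 1)

IsTermRank : {m n : ℕ} → ℕ → Matrix m n → ℕ → Set
IsTermRank {m} {n} t A k =
  Σ (Matrix m n) (λ B → Admissible t A B × σ B ≡ k) ×
  ((B : Matrix m n) → Admissible t A B → σ B ≤ k)

onesCols : {m n : ℕ} → Matrix m n → Subset n
onesCols {m} {n} B = tabulate (λ j → does (s B j ≟ 1))

-- Take a t-optimal B and a (t-1)-optimal C₀. While some row i of B carries fewer
-- 1s than the same row of C₀, pick a column j with C₀ i j = 1 and B i j = 0 and
-- replace column j of B by column j of C₀: the result is still t-admissible, σ does
-- not drop (column j had at most one 1 and now has exactly one), and the number of
-- 1s of C₀ not covered by B strictly decreases. At the end every row of B dominates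
-- the corresponding row of C₀, so keeping the first t-1 ones of every row of B gives
-- a (t-1)-admissible C ≤ B with σ C ≥ σ C₀, i.e. a (t-1)-optimal one. Since column
-- sums are at most 1, σ of such a matrix counts its nonzero columns.
module Submission where

open import Data.Bool.Base using (Bool)
open import Data.Fin.Base using (Fin; zero; suc; toℕ; finToFun; funToFin)
open import Data.Fin.Properties using (any?; all?; finToFun-funToFin)
  renaming (_≟_ to _≟ᶠ_; suc-injective to suc-injectiveᶠ)
open import Data.Fin.Subset using (Subset; inside; outside; _∈_; _∉_; _⊆_; ∣_∣)
open import Data.Fin.Subset.Properties using (drop-there)
open import Data.List.Base using (List; filter; map; allFin)
open import Data.List.Membership.Propositional using () renaming (_∈_ to _∈ˡ_)
open import Data.List.Membership.Propositional.Properties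
  using (∈-filter⁺; ∈-map⁺; ∈-allFin)
open import Data.List.Relation.Unary.All using () renaming (lookup to lookupᴬ)
open import Data.List.Relation.Unary.All.Properties using (all-filter)
open import Data.Nat.Base
open import Data.Nat.Induction using (<-wellFounded)
open import Data.Nat.Properties
open import Algebra.Properties.CommutativeSemigroup +-commutativeSemigroup
  using (interchange; xy∙z≈zy∙x)
open import Data.List.Extrema ≤-totalOrder using (argmax; argmax-all; f[xs]≤f[argmax])
open import Data.Product.Base using (Σ; ∃; _×_; _,_)
open import Data.Sum.Base using (_⊎_; inj₁; inj₂)
open import Data.Vec.Base using ([]; _∷_; lookup; here; there)
open import Data.Vec.Properties using (lookup∘tabulate; []=⇒lookup; lookup⇒[]=)
open import Function.Base using (_∘_)
open import Induction.WellFounded using (Acc; acc)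
open import Relation.Binary.PropositionalEquality
open import Relation.Nullary.Decidable using (Dec; yes; no; does; _×-dec_; _⊎-dec_; dec-true; dec-false)
open import Relation.Nullary.Negation using (contradiction)

open import Defs

private
  variable
    k m n t c : ℕ

∑-cong : ∀ k {f g : Fin k → ℕ} → (∀ j → f j ≡ g j) → ∑ k f ≡ ∑ k g
∑-cong zero    f≗g = refl
∑-cong (suc k) f≗g = cong₂ _+_ (f≗g zero) (∑-cong k (f≗g ∘ suc))

∑-mono : ∀ k {f g : Fin k → ℕ} → (∀ j → f j ≤ g j) → ∑ k f ≤ ∑ k g
∑-mono zero    f≤g = z≤n
∑-mono (suc k) f≤g = +-mono-≤ (f≤g zero) (∑-mono k (f≤g ∘ suc))

∑-mono-< : ∀ k {f g : Fin k → ℕ} (j : Fin k) →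
           (∀ j → f j ≤ g j) → f j < g j → ∑ k f < ∑ k g
∑-mono-< (suc k) zero    f≤g fj<gj = +-mono-<-≤ fj<gj (∑-mono k (f≤g ∘ suc))
∑-mono-< (suc k) (suc j) f≤g fj<gj = +-mono-≤-< (f≤g zero) (∑-mono-< k j (f≤g ∘ suc) fj<gj)

∑-<⇒∃< : ∀ k {f g : Fin k → ℕ} → ∑ k f < ∑ k g → ∃ λ j → f j < g j
∑-<⇒∃< k {f} {g} ∑f<∑g with any? (λ j → f j <? g j)
... | yes fj<gj = fj<gj
... | no ∄     = contradiction (∑-mono k (λ j → ≮⇒≥ (∄ ∘ (j ,_)))) (<⇒≱ ∑f<∑g)

∑-zero : ∀ k → ∑ k (λ _ → 0) ≡ 0
∑-zero zero    = refl
∑-zero (suc k) = ∑-zero k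

∑-+ : ∀ k (f g : Fin k → ℕ) → ∑ k (λ j → f j + g j) ≡ ∑ k f + ∑ k g
∑-+ zero    f g = refl
∑-+ (suc k) f g = trans (cong (f zero + g zero +_) (∑-+ k (f ∘ suc) (g ∘ suc)))
                        (interchange (f zero) (g zero) _ _)

∑-point : ∀ k (f : Fin k → ℕ) j → f j ≤ ∑ k f
∑-point (suc k) f zero    = m≤m+n _ _
∑-point (suc k) f (suc j) = ≤-trans (∑-point k (f ∘ suc) j) (m≤n+m _ _)

∑-pair : ∀ k (f : Fin k → ℕ) {a b} → a ≢ b → f a + f b ≤ ∑ k f
∑-pair (suc k) f {zero}  {zero}  a≢b = contradiction refl a≢b
∑-pair (suc k) f {zero}  {suc b} _   = +-monoʳ-≤ (f zero) (∑-point k (f ∘ suc) b)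
∑-pair (suc k) f {suc a} {zero}  _   =
  ≤-trans (≤-reflexive (+-comm (f (suc a)) _)) (+-monoʳ-≤ (f zero) (∑-point k (f ∘ suc) a))
∑-pair (suc k) f {suc a} {suc b} a≢b =
  ≤-trans (∑-pair k (f ∘ suc) (a≢b ∘ cong suc)) (m≤n+m _ _)

∑-update : ∀ k (f g : Fin k → ℕ) (j : Fin k) →
           (∀ i → i ≢ j → f i ≡ g i) → ∑ k f + g j ≡ ∑ k g + f j
∑-update (suc k) f g zero f≈g = begin
  (f zero + ∑ k (f ∘ suc)) + g zero
    ≡⟨ cong (λ F → f zero + F + g zero) (∑-cong k (λ i → f≈g (suc i) λ ())) ⟩
  (f zero + ∑ k (g ∘ suc)) + g zero ≡⟨ xy∙z≈zy∙x (f zero) _ (g zero) ⟩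
  (g zero + ∑ k (g ∘ suc)) + f zero ∎
  where open ≡-Reasoning
∑-update (suc k) f g (suc j) f≈g = begin
  (f zero + ∑ k (f ∘ suc)) + g (suc j) ≡⟨ +-assoc (f zero) _ _ ⟩
  f zero + (∑ k (f ∘ suc) + g (suc j))
    ≡⟨ cong₂ _+_ (f≈g zero λ ()) (∑-update k (f ∘ suc) (g ∘ suc) j tail≈) ⟩
  g zero + (∑ k (g ∘ suc) + f (suc j)) ≡⟨ +-assoc (g zero) _ _ ⟨
  (g zero + ∑ k (g ∘ suc)) + f (suc j) ∎
  where
  open ≡-Reasoning
  tail≈ : ∀ i → i ≢ j → f (suc i) ≡ g (suc i)
  tail≈ i i≢j = f≈g (suc i) (i≢j ∘ suc-injectiveᶠ)

Is01⇒≤1 : {X : Matrix m n} → Is01 X → ∀ i j → X i j ≤ 1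
Is01⇒≤1 X01 i j with X01 i j
... | inj₁ Xij≡0 = ≤-trans (≤-reflexive Xij≡0) z≤n
... | inj₂ Xij≡1 = ≤-reflexive Xij≡1

Is01-≤ₘ : {X Y : Matrix m n} → Y ≤ₘ X → Is01 X → Is01 Y
Is01-≤ₘ Y≤X X01 i j = n≤1⇒n≡0∨n≡1 (≤-trans (Y≤X i j) (Is01⇒≤1 X01 i j))

≤ₘ-trans : {X Y Z : Matrix m n} → X ≤ₘ Y → Y ≤ₘ Z → X ≤ₘ Z
≤ₘ-trans X≤Y Y≤Z i j = ≤-trans (X≤Y i j) (Y≤Z i j)

s-mono : {X Y : Matrix m n} → X ≤ₘ Y → ∀ j → s X j ≤ s Y j
s-mono {m} X≤Y j = ∑-mono m (λ i → X≤Y i j)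

σ-cong : {X Y : Matrix m n} → (∀ i j → X i j ≡ Y i j) → σ X ≡ σ Y
σ-cong {m} {n} X≗Y = ∑-cong m (λ i → ∑-cong n (X≗Y i))

Admissible-cong : {A X Y : Matrix m n} →
                  (∀ i j → X i j ≡ Y i j) → Admissible t A X → Admissible t A Y
Admissible-cong {m} {n} {t} {A} X≗Y (X01 , X≤A , rX≤t , sX≤1) =
  (λ i j → subst (λ x → (x ≡ 0) ⊎ (x ≡ 1)) (X≗Y i j) (X01 i j)) ,
  (λ i j → subst (_≤ A i j) (X≗Y i j) (X≤A i j)) ,
  (λ i → subst (_≤ t) (∑-cong n (X≗Y i)) (rX≤t i)) ,
  (λ j → subst (_≤ 1) (∑-cong m (λ i → X≗Y i j)) (sX≤1 j))

Admissible-mono : {A B : Matrix m n} → c ≤ t → Admissible c A B → Admissible t A B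
Admissible-mono c≤t (B01 , B≤A , rB≤c , sB≤1) =
  B01 , B≤A , (λ i → ≤-trans (rB≤c i) c≤t) , sB≤1

columnsTail : Matrix m (suc n) → Matrix m n
columnsTail X i j = X i (suc j)

σ-peel : (X : Matrix m (suc n)) → σ X ≡ s X zero + σ (columnsTail X)
σ-peel {m} X = ∑-+ m _ _

σ≡∑s : (X : Matrix m n) → σ X ≡ ∑ n (s X)
σ≡∑s {m} {zero}  X = ∑-zero m
σ≡∑s {m} {suc n} X = trans (σ-peel X) (cong (s X zero +_) (σ≡∑s (columnsTail X)))

σCols-peel : (X : Matrix m (suc n)) (K : Subset n) →
             σCols X (inside ∷ K) ≡ s X zero + σCols (columnsTail X) K
σCols-peel {m} X K = ∑-+ m _ _

vanishing-tail : (X : Matrix m (suc n)) {b : Bool} {K : Subset n} →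
                 (∀ j → j ∉ b ∷ K → s X j ≡ 0) → ∀ j → j ∉ K → s (columnsTail X) j ≡ 0
vanishing-tail X K̅⇒0 j j∉K = K̅⇒0 (suc j) (j∉K ∘ drop-there)

σCols≡σ : (X : Matrix m n) (K : Subset n) →
          (∀ j → j ∉ K → s X j ≡ 0) → σCols X K ≡ σ X
σCols≡σ X []            _     = refl
σCols≡σ X (inside ∷ K)  K̅⇒0 = begin
  σCols X (inside ∷ K)               ≡⟨ σCols-peel X K ⟩
  s X zero + σCols (columnsTail X) K
    ≡⟨ cong (s X zero +_) (σCols≡σ (columnsTail X) K (vanishing-tail X K̅⇒0)) ⟩
  s X zero + σ (columnsTail X)       ≡⟨ σ-peel X ⟨
  σ X                                ∎
  where open ≡-Reasoning
σCols≡σ X (outside ∷ K) K̅⇒0 = begin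
  σCols (columnsTail X) K            ≡⟨ σCols≡σ (columnsTail X) K (vanishing-tail X K̅⇒0) ⟩
  σ (columnsTail X)                  ≡⟨ cong (_+ σ (columnsTail X)) (K̅⇒0 zero λ ()) ⟨
  s X zero + σ (columnsTail X)       ≡⟨ σ-peel X ⟨
  σ X                                ∎
  where open ≡-Reasoning

∣K∣≡σ : (X : Matrix m n) (K : Subset n) →
        (∀ j → j ∈ K → s X j ≡ 1) → (∀ j → j ∉ K → s X j ≡ 0) → ∣ K ∣ ≡ σ X
∣K∣≡σ {m} X [] _ _ = sym (∑-zero m)
∣K∣≡σ X (b ∷ K) K⇒1 K̅⇒0 = begin
  ∣ b ∷ K ∣                    ≡⟨ head-contribution b (K⇒1 zero) (K̅⇒0 zero) ⟩
  s X zero + ∣ K ∣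
    ≡⟨ cong (s X zero +_) (∣K∣≡σ (columnsTail X) K tail⇒1 (vanishing-tail X K̅⇒0)) ⟩
  s X zero + σ (columnsTail X) ≡⟨ σ-peel X ⟨
  σ X                          ∎
  where
  open ≡-Reasoning
  tail⇒1 : ∀ j → j ∈ K → s (columnsTail X) j ≡ 1
  tail⇒1 j = K⇒1 (suc j) ∘ there
  head-contribution : ∀ b → (zero ∈ b ∷ K → s X zero ≡ 1) → (zero ∉ b ∷ K → s X zero ≡ 0) →
                      ∣ b ∷ K ∣ ≡ s X zero + ∣ K ∣
  head-contribution inside  ∈⇒1 _   = cong (_+ ∣ K ∣) (sym (∈⇒1 here))
  head-contribution outside _   ∉⇒0 = cong (_+ ∣ K ∣) (sym (∉⇒0 λ ()))

module _ {m n : ℕ} {X : Matrix m n} where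

  onesCols-lookup : ∀ j → lookup (onesCols X) j ≡ does (s X j ≟ 1)
  onesCols-lookup = lookup∘tabulate (λ j → does (s X j ≟ 1))

  ∈-onesCols⁺ : ∀ {j} → s X j ≡ 1 → j ∈ onesCols X
  ∈-onesCols⁺ {j} sXj≡1 =
    lookup⇒[]= j (onesCols X) (trans (onesCols-lookup j) (dec-true (s X j ≟ 1) sXj≡1))

  ∈-onesCols⁻ : ∀ {j} → j ∈ onesCols X → s X j ≡ 1
  ∈-onesCols⁻ {j} j∈K with s X j ≟ 1
  ... | yes sXj≡1 = sXj≡1
  ... | no sXj≢1  = contradiction
    (trans (sym ([]=⇒lookup j∈K)) (trans (onesCols-lookup j) (dec-false (s X j ≟ 1) sXj≢1))) λ ()

  ∉-onesCols : (∀ j → s X j ≤ 1) → ∀ {j} → j ∉ onesCols X → s X j ≡ 0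
  ∉-onesCols sX≤1 {j} j∉K with n≤1⇒n≡0∨n≡1 (sX≤1 j)
  ... | inj₁ sXj≡0 = sXj≡0
  ... | inj₂ sXj≡1 = contradiction (∈-onesCols⁺ sXj≡1) j∉K

  σ≡σCols-onesCols : (∀ j → s X j ≤ 1) → σ X ≡ σCols X (onesCols X)
  σ≡σCols-onesCols sX≤1 = sym (σCols≡σ X (onesCols X) (λ j → ∉-onesCols sX≤1))

  σ≡∣onesCols∣ : (∀ j → s X j ≤ 1) → σ X ≡ ∣ onesCols X ∣
  σ≡∣onesCols∣ sX≤1 = sym (∣K∣≡σ X (onesCols X) (λ j → ∈-onesCols⁻) (λ j → ∉-onesCols sX≤1))

onesCols-mono : {X Y : Matrix m n} → X ≤ₘ Y → (∀ j → s Y j ≤ 1) → onesCols X ⊆ onesCols Y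
onesCols-mono {X = X} {Y} X≤Y sY≤1 {j} j∈K =
  ∈-onesCols⁺ {X = Y} (≤-antisym (sY≤1 j) (begin
    1       ≡⟨ ∈-onesCols⁻ {X = X} j∈K ⟨
    s X j   ≤⟨ s-mono X≤Y j ⟩
    s Y j   ∎))
  where open ≤-Reasoning

Optimal : ℕ → Matrix m n → Matrix m n → Set
Optimal {m} {n} t A B = Admissible t A B × ((B′ : Matrix m n) → Admissible t A B′ → σ B′ ≤ σ B)

isTermRank-≥ : {A B₀ B : Matrix m n} →
               Optimal t A B₀ → Admissible t A B → σ B₀ ≤ σ B → IsTermRank t A (σ B)
isTermRank-≥ {B = B} (_ , B₀-max) admB σB₀≤σB =
  (B , admB , refl) , λ B′ admB′ → ≤-trans (B₀-max B′ admB′) σB₀≤σB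

admissible? : ∀ t (A X : Matrix m n) → Dec (Admissible t A X)
admissible? t A X =
  all? (λ i → all? λ j → (X i j ≟ 0) ⊎-dec (X i j ≟ 1)) ×-dec
  all? (λ i → all? λ j → X i j ≤? A i j) ×-dec
  all? (λ i → r X i ≤? t) ×-dec
  all? (λ j → s X j ≤? 1)

𝟎-admissible : (A : Matrix m n) → Admissible t A (λ _ _ → 0)
𝟎-admissible {m} {n} A =
  (λ _ _ → inj₁ refl) , (λ _ _ → z≤n) ,
  (λ _ → ≤-trans (≤-reflexive (∑-zero n)) z≤n) , (λ _ → ≤-trans (≤-reflexive (∑-zero m)) z≤n)

-- Rows Fin n → Fin 2 are coded in Fin (2 ^ n), matrices Fin m → Fin (2 ^ n) in Fin ((2 ^ n) ^ m).
decode : ∀ {m n} → Fin ((2 ^ n) ^ m) → Matrix m n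
decode code i j = toℕ (finToFun (finToFun code i) j)

bit : ℕ → Fin 2
bit zero    = zero
bit (suc _) = suc zero

toℕ-bit : ∀ {x} → (x ≡ 0) ⊎ (x ≡ 1) → toℕ (bit x) ≡ x
toℕ-bit (inj₁ refl) = refl
toℕ-bit (inj₂ refl) = refl

encode : Matrix m n → Fin ((2 ^ n) ^ m)
encode X = funToFin (λ i → funToFin (λ j → bit (X i j)))

decode-encode : {X : Matrix m n} → Is01 X → ∀ i j → decode (encode X) i j ≡ X i j
decode-encode {X = X} X01 i j = begin
  toℕ (finToFun (finToFun (encode X) i) j)
    ≡⟨ cong (λ row → toℕ (finToFun row j)) (finToFun-funToFin _ i) ⟩
  toℕ (finToFun (funToFin (λ j → bit (X i j))) j) ≡⟨ cong toℕ (finToFun-funToFin _ j) ⟩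
  toℕ (bit (X i j))                                ≡⟨ toℕ-bit (X01 i j) ⟩
  X i j                                            ∎
  where open ≡-Reasoning

optimal-exists : ∀ t (A : Matrix m n) → Σ (Matrix m n) (Optimal t A)
optimal-exists {m} {n} t A =
  B* , argmax-all σ (𝟎-admissible A) (all-filter (admissible? t A) codes) , dominates
  where
  codes candidates : List (Matrix m n)
  codes      = map decode (allFin ((2 ^ n) ^ m))
  candidates = filter (admissible? t A) codes

  B* : Matrix m n
  B* = argmax σ (λ _ _ → 0) candidates

  dominates : (B : Matrix m n) → Admissible t A B → σ B ≤ σ B*
  dominates B admB@(B01 , _) = begin
    σ B                          ≡⟨ σ-cong (decode-encode B01) ⟨
    σ (decode {m} {n} (encode B))
      ≤⟨ lookupᴬ (f[xs]≤f[argmax] {f = σ} (λ _ _ → 0) candidates) encoded∈candidates ⟩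
    σ B*                          ∎
    where
    open ≤-Reasoning
    encoded∈candidates : decode (encode B) ∈ˡ candidates
    encoded∈candidates = ∈-filter⁺ (admissible? t A) (∈-map⁺ decode (∈-allFin (encode B)))
      (Admissible-cong (λ i j → sym (decode-encode B01 i j)) admB)

setColumn : Matrix m n → Fin n → (Fin m → ℕ) → Matrix m n
setColumn B j v i j′ with j′ ≟ᶠ j
... | yes _ = v i
... | no  _ = B i j′

module _ {m n : ℕ} (B : Matrix m n) (j : Fin n) (v : Fin m → ℕ) where

  setColumn-≡ : ∀ i → setColumn B j v i j ≡ v i
  setColumn-≡ i with j ≟ᶠ j
  ... | yes _   = refl
  ... | no j≢j = contradiction refl j≢j

  setColumn-≢ : ∀ i {j′} → j′ ≢ j → setColumn B j v i j′ ≡ B i j′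
  setColumn-≢ i {j′} j′≢j with j′ ≟ᶠ j
  ... | yes j′≡j = contradiction j′≡j j′≢j
  ... | no  _    = refl

  setColumn-columnwise : (P : Fin n → (Fin m → ℕ) → Set) →
                         (∀ j′ → P j′ (λ i → B i j′)) → P j v →
                         ∀ j′ → P j′ (λ i → setColumn B j v i j′)
  setColumn-columnwise P PB Pv j′ with j′ ≟ᶠ j
  ... | yes refl = Pv
  ... | no  _    = PB j′

  setColumn-pointwise : (P : Fin m → Fin n → ℕ → Set) →
                        (∀ i j′ → P i j′ (B i j′)) → (∀ i → P i j (v i)) →
                        ∀ i j′ → P i j′ (setColumn B j v i j′)
  setColumn-pointwise P PB Pv i j′ =
    setColumn-columnwise (λ j′ col → ∀ i → P i j′ (col i)) (λ j′ i → PB i j′) Pv j′ i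

  setColumn-r : ∀ i → r (setColumn B j v) i + B i j ≡ r B i + v i
  setColumn-r i = trans (∑-update n (setColumn B j v i) (B i) j (λ j′ → setColumn-≢ i))
                        (cong (r B i +_) (setColumn-≡ i))

m<n≤1⇒m≡0∧n≡1 : ∀ {x y} → x < y → y ≤ 1 → x ≡ 0 × y ≡ 1
m<n≤1⇒m≡0∧n≡1 (s≤s z≤n) (s≤s z≤n) = refl , refl

module Exchange {m n t : ℕ} {A C : Matrix m n} (C01 : Is01 C) (C≤A : C ≤ₘ A)
                (rC≤t : ∀ i → r C i ≤ t) (sC≤1 : ∀ j → s C j ≤ 1) where

  uncoveredIn : Matrix m n → Fin n → ℕ
  uncoveredIn X j = ∑ m (λ i → C i j ∸ X i j)

  uncovered : Matrix m n → ℕ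
  uncovered X = ∑ n (uncoveredIn X)

  repair : Matrix m n → Fin n → Matrix m n
  repair B j = setColumn B j (λ i → C i j)

  column-unique : ∀ {i i′ j} → C i j ≡ 1 → i′ ≢ i → C i′ j ≡ 0
  column-unique {i} {i′} {j} Cij≡1 i′≢i = n≤0⇒n≡0 (+-cancelˡ-≤ 1 _ _ (begin
    1 + C i′ j     ≡⟨ cong (_+ C i′ j) Cij≡1 ⟨
    C i j + C i′ j ≤⟨ ∑-pair m (λ i → C i j) (i′≢i ∘ sym) ⟩
    s C j          ≤⟨ sC≤1 j ⟩
    1              ∎))
    where open ≤-Reasoning

  module _ {B : Matrix m n} {i : Fin m} {j : Fin n} (Cij≡1 : C i j ≡ 1) (Bij≡0 : B i j ≡ 0) where

    repair-r : r B i < r C i → ∀ {i′} → r B i′ ≤ t → r (repair B j) i′ ≤ t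
    repair-r rBi<rCi {i′} rBi′≤t with i′ ≟ᶠ i
    ... | yes refl = begin
      r (repair B j) i               ≡⟨ +-identityʳ _ ⟨
      r (repair B j) i + 0           ≡⟨ cong (r (repair B j) i +_) Bij≡0 ⟨
      r (repair B j) i + B i j       ≡⟨ setColumn-r B j _ i ⟩
      r B i + C i j                  ≡⟨ trans (cong (r B i +_) Cij≡1) (+-comm _ 1) ⟩
      suc (r B i)                    ≤⟨ rBi<rCi ⟩
      r C i                          ≤⟨ rC≤t i ⟩
      t                              ∎
      where open ≤-Reasoning
    ... | no i′≢i = begin
      r (repair B j) i′              ≤⟨ m≤m+n _ _ ⟩
      r (repair B j) i′ + B i′ j     ≡⟨ setColumn-r B j _ i′ ⟩
      r B i′ + C i′ j                ≡⟨ cong (r B i′ +_) (column-unique Cij≡1 i′≢i) ⟩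
      r B i′ + 0                     ≡⟨ +-identityʳ _ ⟩
      r B i′                         ≤⟨ rBi′≤t ⟩
      t                              ∎
      where open ≤-Reasoning

    repair-admissible : Admissible t A B → r B i < r C i → Admissible t A (repair B j)
    repair-admissible (B01 , B≤A , rB≤t , sB≤1) rBi<rCi =
      setColumn-pointwise B j _ (λ _ _ x → (x ≡ 0) ⊎ (x ≡ 1)) B01 (λ i → C01 i j) ,
      setColumn-pointwise B j _ (λ i j x → x ≤ A i j) B≤A (λ i → C≤A i j) ,
      (λ i′ → repair-r rBi<rCi (rB≤t i′)) ,
      setColumn-columnwise B j _ (λ _ col → ∑ m col ≤ 1) sB≤1 (sC≤1 j)

    repair-σ : (∀ j → s B j ≤ 1) → σ B ≤ σ (repair B j)
    repair-σ sB≤1 = begin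
      σ B                  ≡⟨ σ≡∑s B ⟩
      ∑ n (s B)            ≤⟨ ∑-mono n columns ⟩
      ∑ n (s (repair B j)) ≡⟨ σ≡∑s (repair B j) ⟨
      σ (repair B j)       ∎
      where
      open ≤-Reasoning
      sBj≤sCj : s B j ≤ s C j
      sBj≤sCj = begin
        s B j              ≤⟨ sB≤1 j ⟩
        1                  ≡⟨ Cij≡1 ⟨
        C i j              ≤⟨ ∑-point m (λ i → C i j) i ⟩
        s C j              ∎
      columns : ∀ j′ → s B j′ ≤ s (repair B j) j′
      columns = setColumn-columnwise B j _ (λ j′ col → s B j′ ≤ ∑ m col) (λ _ → ≤-refl) sBj≤sCj

    repair-uncovered : uncovered (repair B j) < uncovered B
    repair-uncovered = ∑-mono-< n j columns (begin-strict
      uncoveredIn (repair B j) j ≡⟨ repaired ⟩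
      0                          <⟨ z<s ⟩
      1                          ≡⟨ cong₂ _∸_ Cij≡1 Bij≡0 ⟨
      C i j ∸ B i j              ≤⟨ ∑-point m (λ i → C i j ∸ B i j) i ⟩
      uncoveredIn B j            ∎)
      where
      open ≤-Reasoning
      copied : ∑ m (λ i → C i j ∸ C i j) ≡ 0
      copied = trans (∑-cong m (λ i → n∸n≡0 (C i j))) (∑-zero m)
      repaired : uncoveredIn (repair B j) j ≡ 0
      repaired = trans (∑-cong m (λ i → cong (C i j ∸_) (setColumn-≡ B j _ i))) copied
      columns : ∀ j′ → uncoveredIn (repair B j) j′ ≤ uncoveredIn B j′
      columns = setColumn-columnwise B j _
        (λ j′ col → ∑ m (λ i → C i j′ ∸ col i) ≤ uncoveredIn B j′)
        (λ _ → ≤-refl) (≤-trans (≤-reflexive copied) z≤n)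

  exchange : (B : Matrix m n) → Admissible t A B → Acc _<_ (uncovered B) →
             Σ (Matrix m n) λ B′ → Admissible t A B′ × σ B ≤ σ B′ × (∀ i → r C i ≤ r B′ i)
  exchange B admB@(_ , _ , _ , sB≤1) (acc rec) with any? (λ i → r B i <? r C i)
  ... | no ∄ = B , admB , ≤-refl , λ i → ≮⇒≥ (∄ ∘ (i ,_))
  ... | yes (i , rBi<rCi) with ∑-<⇒∃< n rBi<rCi
  ...   | j , Bij<Cij with m<n≤1⇒m≡0∧n≡1 Bij<Cij (Is01⇒≤1 C01 i j)
  ...     | Bij≡0 , Cij≡1 with exchange (repair B j) (repair-admissible Cij≡1 Bij≡0 admB rBi<rCi)
                                         (rec (repair-uncovered Cij≡1 Bij≡0))
  ...       | B′ , admB′ , σ≤σB′ , rC≤rB′ =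
    B′ , admB′ , ≤-trans (repair-σ Cij≡1 Bij≡0 sB≤1) σ≤σB′ , rC≤rB′

dominate-rows : {A B C : Matrix m n} → Admissible t A C → Admissible t A B →
                Σ (Matrix m n) λ B′ → Admissible t A B′ × σ B ≤ σ B′ × (∀ i → r C i ≤ r B′ i)
dominate-rows (C01 , C≤A , rC≤t , sC≤1) admB =
  Exchange.exchange C01 C≤A rC≤t sC≤1 _ admB (<-wellFounded _)

cap : ℕ → (Fin k → ℕ) → Fin k → ℕ
cap c f zero    = c ⊓ f zero
cap c f (suc j) = cap (c ∸ f zero) (f ∘ suc) j

⊓-+-∸ : ∀ c a b → c ⊓ a + (c ∸ a) ⊓ b ≡ c ⊓ (a + b)
⊓-+-∸ zero    zero    b = refl
⊓-+-∸ zero    (suc a) b = refl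
⊓-+-∸ (suc c) zero    b = refl
⊓-+-∸ (suc c) (suc a) b = cong suc (⊓-+-∸ c a b)

∑-cap : ∀ k c (f : Fin k → ℕ) → ∑ k (cap c f) ≡ c ⊓ ∑ k f
∑-cap zero    c f = sym (⊓-zeroʳ c)
∑-cap (suc k) c f =
  trans (cong (c ⊓ f zero +_) (∑-cap k (c ∸ f zero) (f ∘ suc))) (⊓-+-∸ c (f zero) _)

cap-≤ : ∀ c (f : Fin k → ℕ) j → cap c f j ≤ f j
cap-≤ c f zero    = m⊓n≤n c (f zero)
cap-≤ c f (suc j) = cap-≤ (c ∸ f zero) (f ∘ suc) j

capRows : ℕ → Matrix m n → Matrix m n
capRows c B i = cap c (B i)

module _ {m n c : ℕ} {B : Matrix m n} where

  capRows-≤ₘ : capRows c B ≤ₘ B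
  capRows-≤ₘ i = cap-≤ c (B i)

  r-capRows : ∀ i → r (capRows c B) i ≡ c ⊓ r B i
  r-capRows i = ∑-cap n c (B i)

  capRows-admissible : {A : Matrix m n} → Admissible t A B → Admissible c A (capRows c B)
  capRows-admissible (B01 , B≤A , _ , sB≤1) =
    Is01-≤ₘ capRows-≤ₘ B01 , ≤ₘ-trans capRows-≤ₘ B≤A ,
    (λ i → ≤-trans (≤-reflexive (r-capRows i)) (m⊓n≤m c _)) ,
    (λ j → ≤-trans (s-mono capRows-≤ₘ j) (sB≤1 j))

  σ-capRows-≥ : {A C : Matrix m n} → Admissible c A C → (∀ i → r C i ≤ r B i) →
                σ C ≤ σ (capRows c B)
  σ-capRows-≥ (_ , _ , rC≤c , _) rC≤rB =
    ∑-mono m (λ i → ≤-trans (⊓-glb (rC≤c i) (rC≤rB i)) (≤-reflexive (sym (r-capRows i))))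

proposition2p2 : (m n t : ℕ) → (A : Matrix m n) → Is01 A → 2 ≤ t →
    Σ (Matrix m n) (λ B →
      Admissible t A B
      × IsTermRank t A (σ B)
      × σ B ≡ σCols B (onesCols B)
      × σ B ≡ ∣ onesCols B ∣
      × Σ (Matrix m n) (λ C →
          Is01 C × C ≤ₘ B
          × Admissible (t ∸ 1) A C
          × IsTermRank (t ∸ 1) A (σ C)
          × Σ (Subset n) (λ K′ →
              K′ ⊆ onesCols B
              × σ C ≡ σCols C K′
              × ∣ K′ ∣ ≡ σ C)))
proposition2p2 m n t A _ _ with optimal-exists t A | optimal-exists (t ∸ 1) A
... | Bₜ , Bₜ-opt@(admBₜ , _) | C₀ , C₀-opt@(admC₀ , _)
  with dominate-rows (Admissible-mono (m∸n≤m t 1) admC₀) admBₜ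
... | B , admB@(B01 , _ , _ , sB≤1) , σBₜ≤σB , rC₀≤rB =
  B , admB , isTermRank-≥ Bₜ-opt admB σBₜ≤σB ,
  σ≡σCols-onesCols {X = B} sB≤1 , σ≡∣onesCols∣ {X = B} sB≤1 ,
  C , Is01-≤ₘ C≤B B01 , C≤B , admC , isTermRank-≥ C₀-opt admC (σ-capRows-≥ admC₀ rC₀≤rB) ,
  onesCols C , onesCols-mono C≤B sB≤1 ,
  σ≡σCols-onesCols {X = C} sC≤1 , sym (σ≡∣onesCols∣ {X = C} sC≤1)
  where
  C : Matrix m n
  C = capRows (t ∸ 1) B
  C≤B : C ≤ₘ B
  C≤B = capRows-≤ₘ
  admC : Admissible (t ∸ 1) A C
  admC = capRows-admissible admB
  sC≤1 : ∀ j → s C j ≤ 1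
  sC≤1 j = ≤-trans (s-mono C≤B j) (sB≤1 j)
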